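{- Let $\mathcal{D}$ be a symmetric $2$-$(56,11,2)$ design (biplane) with point set $\{1,\dots,56\}$, and let $B=\{46,\dots,56\}$ be a block of $\mathcal{D}$. Order the blocks of $\mathcal{D}$ so that $B$ is the last one, and let $A$ be the $56\times 56$ points-by-blocks incidence matrix of $\mathcal{D}$, so that $$A=\begin{pmatrix} A'' & \bar 0\\ A' & \bar 1\end{pmatrix},$$ where $A''$ is the $45\times 55$ incidence matrix of the residual design $\mathcal{D}_B$ (a $2$-$(45,9,2)$ design on points $1,\dots,45$), $A'$ is the $11\times 55$ incidence matrix of the derived design $\mathcal{D}^B$ (a $2$-$(11,2,1)$ design on the points of $B$), and $\bar 0,\bar 1$ are the all-zero and all-one columns. Let $L''$ be the ternary linear code (over $GF(3)$) spanned by the rows of $A''$ and $L$ the ternary linear code spanned by the rows of $A$. If $c=(c_1,\dots,c_{55})$ is a $(0,1)$-vector of weight $12$ belonging to $(L'')^\perp$, then $c^*=(c_1,\dots,c_{55},0)$ belongs to $L^\perp$.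
   Context: A $2$-$(v,k,\lambda)$ design is symmetric if it has exactly $v$ blocks; a biplane is a symmetric design with $\lambda=2$. For a block $B$ of a design with point set $X$ and block set $\mathcal{B}$, the residual design $\mathcal{D}_B$ has point set $X\setminus B$ and blocks $B_j\setminus B$ for $B_j\in\mathcal{B}$, $B_j\ne B$; the derived design $\mathcal{D}^B$ has point set $B$ and blocks $B\cap B_j$ for $B_j\ne B$. Dual codes are with respect to the standard inner product over $GF(3)$. -}

module Defs where

open import Data.Nat using (ℕ; zero; suc; _≤ᵇ_)
open import Data.Bool using (Bool; true; false; if_then_else_)
open import Data.Fin using (Fin; zero; suc; toℕ; _↑ˡ_; inject₁; fromℕ)
open import Data.Product using (Σ; _×_; _,_)
open import Relation.Binary.PropositionalEquality using (_≡_; _≢_)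

data GF3 : Set where
  𝟘 𝟙 𝟚 : GF3

_⊕_ : GF3 → GF3 → GF3
𝟘 ⊕ y = y
x ⊕ 𝟘 = x
𝟙 ⊕ 𝟙 = 𝟚
𝟙 ⊕ 𝟚 = 𝟘
𝟚 ⊕ 𝟙 = 𝟘
𝟚 ⊕ 𝟚 = 𝟙

_⊗_ : GF3 → GF3 → GF3
𝟘 ⊗ _ = 𝟘
𝟙 ⊗ y = y
𝟚 ⊗ 𝟘 = 𝟘
𝟚 ⊗ 𝟙 = 𝟚
𝟚 ⊗ 𝟚 = 𝟙

Σ₃ : (n : ℕ) → (Fin n → GF3) → GF3
Σ₃ zero f = 𝟘
Σ₃ (suc n) f = f zero ⊕ Σ₃ n (λ i → f (suc i))

dot : {n : ℕ} → (Fin n → GF3) → (Fin n → GF3) → GF3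
dot {n} u v = Σ₃ n (λ j → u j ⊗ v j)

InSpan : {m n : ℕ} → (Fin m → Fin n → GF3) → (Fin n → GF3) → Set
InSpan {m} {n} M v = Σ (Fin m → GF3) λ a → (j : Fin n) → v j ≡ Σ₃ m (λ i → a i ⊗ M i j)

InDual : {m n : ℕ} → (Fin m → Fin n → GF3) → (Fin n → GF3) → Set
InDual {m} {n} M c = (v : Fin n → GF3) → InSpan M v → dot v c ≡ 𝟘

count : {n : ℕ} → (Fin n → Bool) → ℕ
count {zero} f = 0
count {suc n} f = (if f zero then 1 else 0) Data.Nat.+ count (λ i → f (suc i))

isZero : GF3 → Bool
isZero 𝟘 = true
isZero _ = false

weight : {n : ℕ} → (Fin n → GF3) → ℕ
weight c = count (λ j → if isZero (c j) then false else true)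

_∧_ : Bool → Bool → Bool
true ∧ b = b
false ∧ _ = false

-- Symmetric 2-(v,k,λ) design given by a v × v points-by-blocks incidence matrix
-- (rows = points, columns = blocks; v blocks)
record IsSymmetricDesign (v k lam : ℕ) (A : Fin v → Fin v → Bool) : Set where
  field
    blockSize : (b : Fin v) → count (λ p → A p b) ≡ k
    pairCount : (p q : Fin v) → p ≢ q → count (λ b → A p b ∧ A q b) ≡ lam

toGF3 : Bool → GF3
toGF3 true = 𝟙
toGF3 false = 𝟘

append0 : {n : ℕ} → (Fin n → GF3) → Fin (suc n) → GF3
append0 {zero} c zero = 𝟘
append0 {suc n} c zero = c zero
append0 {suc n} c (suc j) = append0 (λ i → c (suc i)) j

-- the last block index (block 56, index 55)
lastBlock : Fin 56
lastBlock = fromℕ 55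

ternA : (Fin 56 → Fin 56 → Bool) → Fin 56 → Fin 56 → GF3
ternA A p b = toGF3 (A p b)

-- A'': the 45 × 55 incidence matrix of the residual design D_B
-- (points 1..45 = indices 0..44, blocks other than B = indices 0..54)
A'' : (Fin 56 → Fin 56 → Bool) → Fin 45 → Fin 55 → GF3
A'' A p b = toGF3 (A (p ↑ˡ 11) (inject₁ b))

-- Let x = A c*.  For a point p outside B the row of A at p is the row of A'' followed by 0, so
-- x_p = 0 because c ⊥ L''.  The dual of a symmetric design is a symmetric design with the same
-- parameters, so AᵀA = 9I + 2J ≡ 2J over GF(3), and Aᵀx = AᵀA c* = 2 (Σ c) 𝟏 = 0 because the
-- weight 12 is divisible by 3.  Two points u ≠ v of B lie on exactly one further block, which
-- meets B in {u, v} only, so its coordinate of Aᵀx reads x_u + x_v = 0; three such relations among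
-- three points of B give x = 0 on B too.  Hence A c* = 0, i.e. c* ∈ L⊥.
-- The dual-design fact is the classical count: every point lies on k blocks, and for a block b
-- the sizes μ of its intersections with the other v − 1 blocks satisfy Σ μ = k(k − 1) and
-- Σ μ² = λ k(k − 1) = λ² (v − 1), so Σ (μ − λ)² = 0.

module Submission where

open import Defs
open import Data.Nat using (_≤ᵇ_)
open import Data.Fin using (Fin; toℕ)
open import Data.Bool using (Bool)
open import Data.Sum using (_⊎_)
open import Relation.Binary.PropositionalEquality using (_≡_)

open import Level using (Level; 0ℓ)
open import Function using (_∘_; flip)
open import Data.Nat using (ℕ; zero; suc; _≤_; _<_; z≤n; s≤s)
open import Data.Nat.Tactic.RingSolver using (solve-∀)
open import Data.Bool using (true; false; if_then_else_)
open import Data.Fin using (zero; suc; _≟_; punchIn; punchOut; inject₁; _↑ˡ_; splitAt; #_)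
open import Data.Fin.Properties
  using (punchInᵢ≢i; punchIn-injective; punchIn-punchOut; punchOut-injective; splitAt⁻¹-↑ˡ; splitAt⁻¹-↑ʳ; toℕ-↑ʳ)
open import Data.Sum using (inj₁; inj₂; [_,_]′)
open import Data.Product using (∃; _×_; _,_; proj₁; proj₂)
open import Relation.Nullary using (Dec; yes; no; contradiction)
open import Relation.Nullary.Decidable using (from-yes; _→-dec_; does; dec-true; dec-false)
open import Relation.Binary.Definitions using (DecidableEquality)
open import Relation.Binary.PropositionalEquality as ≡ using (refl; cong; cong₂; _≢_)
open import Relation.Binary.PropositionalEquality.Algebra using (isMagma)
open import Algebra.Bundles using (CommutativeSemiring)
open import Algebra.Structures.Biased using (isCommutativeMonoidˡ; isCommutativeSemiringˡ)
import Algebra.Properties.Semiring.Sum as SemiringSum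
import Relation.Binary.Reasoning.Setoid as SetoidReasoning

infix 4 _≟₃_
_≟₃_ : DecidableEquality GF3
𝟘 ≟₃ 𝟘 = yes refl
𝟙 ≟₃ 𝟙 = yes refl
𝟚 ≟₃ 𝟚 = yes refl
𝟘 ≟₃ 𝟙 = no λ ()
𝟘 ≟₃ 𝟚 = no λ ()
𝟙 ≟₃ 𝟘 = no λ ()
𝟙 ≟₃ 𝟚 = no λ ()
𝟚 ≟₃ 𝟘 = no λ ()
𝟚 ≟₃ 𝟙 = no λ ()

∀₃? : {P : GF3 → Set} → (∀ x → Dec (P x)) → Dec (∀ x → P x)
∀₃? P? with P? 𝟘 | P? 𝟙 | P? 𝟚
... | yes p₀ | yes p₁ | yes p₂ = yes λ { 𝟘 → p₀ ; 𝟙 → p₁ ; 𝟚 → p₂ }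
... | no ¬p₀ | _      | _      = no λ p → ¬p₀ (p 𝟘)
... | yes _  | no ¬p₁ | _      = no λ p → ¬p₁ (p 𝟙)
... | yes _  | yes _  | no ¬p₂ = no λ p → ¬p₂ (p 𝟚)

GF3-commutativeSemiring : CommutativeSemiring 0ℓ 0ℓ
GF3-commutativeSemiring = record
  { Carrier = GF3
  ; _≈_ = _≡_
  ; _+_ = _⊕_
  ; _*_ = _⊗_
  ; 0# = 𝟘
  ; 1# = 𝟙
  ; isCommutativeSemiring = isCommutativeSemiringˡ record
    { +-isCommutativeMonoid = isCommutativeMonoidˡ record
      { isSemigroup = record { isMagma = isMagma _⊕_ ; assoc = ⊕-assoc }
      ; identityˡ = λ _ → refl
      ; comm = ⊕-comm
      }
    ; *-isCommutativeMonoid = isCommutativeMonoidˡ record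
      { isSemigroup = record { isMagma = isMagma _⊗_ ; assoc = ⊗-assoc }
      ; identityˡ = λ _ → refl
      ; comm = ⊗-comm
      }
    ; distribʳ = ⊗-distribʳ-⊕
    ; zeroˡ = λ _ → refl
    }
  }
  where
  ⊕-assoc : ∀ x y z → (x ⊕ y) ⊕ z ≡ x ⊕ (y ⊕ z)
  ⊕-assoc = from-yes (∀₃? λ x → ∀₃? λ y → ∀₃? λ z → (x ⊕ y) ⊕ z ≟₃ x ⊕ (y ⊕ z))
  ⊕-comm : ∀ x y → x ⊕ y ≡ y ⊕ x
  ⊕-comm = from-yes (∀₃? λ x → ∀₃? λ y → x ⊕ y ≟₃ y ⊕ x)
  ⊗-assoc : ∀ x y z → (x ⊗ y) ⊗ z ≡ x ⊗ (y ⊗ z)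
  ⊗-assoc = from-yes (∀₃? λ x → ∀₃? λ y → ∀₃? λ z → (x ⊗ y) ⊗ z ≟₃ x ⊗ (y ⊗ z))
  ⊗-comm : ∀ x y → x ⊗ y ≡ y ⊗ x
  ⊗-comm = from-yes (∀₃? λ x → ∀₃? λ y → x ⊗ y ≟₃ y ⊗ x)
  ⊗-distribʳ-⊕ : ∀ z x y → (x ⊕ y) ⊗ z ≡ (x ⊗ z) ⊕ (y ⊗ z)
  ⊗-distribʳ-⊕ = from-yes (∀₃? λ z → ∀₃? λ x → ∀₃? λ y → (x ⊕ y) ⊗ z ≟₃ (x ⊗ z) ⊕ (y ⊗ z))

pairwise-sums-𝟘⇒𝟘 : ∀ a b c → a ⊕ b ≡ 𝟘 → a ⊕ c ≡ 𝟘 → b ⊕ c ≡ 𝟘 → a ≡ 𝟘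
pairwise-sums-𝟘⇒𝟘 = from-yes (∀₃? λ a → ∀₃? λ b → ∀₃? λ c →
  (a ⊕ b ≟₃ 𝟘) →-dec (a ⊕ c ≟₃ 𝟘) →-dec (b ⊕ c ≟₃ 𝟘) →-dec (a ≟₃ 𝟘))

module FiniteSums {c ℓ : Level} (R : CommutativeSemiring c ℓ) where
  open CommutativeSemiring R
  open SemiringSum semiring public
  open SetoidReasoning setoid

  ∑-bilinear : ∀ {m n} (w : Fin m → Carrier) (M : Fin m → Fin n → Carrier) (u : Fin n → Carrier) →
               ∑[ i < m ] (w i * ∑[ j < n ] (M i j * u j)) ≈ ∑[ j < n ] (∑[ i < m ] (w i * M i j) * u j)
  ∑-bilinear {m} {n} w M u = begin
    ∑[ i < m ] (w i * ∑[ j < n ] (M i j * u j))   ≈⟨ sum-cong-≋ (λ i → *-distribˡ-sum (w i) (λ j → M i j * u j)) ⟩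
    ∑[ i < m ] ∑[ j < n ] (w i * (M i j * u j))   ≈⟨ ∑-comm (λ i j → w i * (M i j * u j)) ⟩
    ∑[ j < n ] ∑[ i < m ] (w i * (M i j * u j))   ≈⟨ sum-cong-≋ (λ j → sum-cong-≋ (λ i → sym (*-assoc (w i) (M i j) (u j)))) ⟩
    ∑[ j < n ] ∑[ i < m ] ((w i * M i j) * u j)   ≈⟨ sum-cong-≋ (λ j → sym (*-distribʳ-sum (u j) (λ i → w i * M i j))) ⟩
    ∑[ j < n ] (∑[ i < m ] (w i * M i j) * u j)   ∎

  sum-supported-at : ∀ {n} (f : Fin (suc n) → Carrier) i → (∀ j → j ≢ i → f j ≈ 0#) → sum f ≈ f i
  sum-supported-at {n} f i vanish = begin
    sum f                      ≈⟨ sum-remove f ⟩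
    f i + sum (f ∘ punchIn i)  ≈⟨ +-congˡ (sum-cong-≋ (λ j → vanish (punchIn i j) (punchInᵢ≢i i j))) ⟩
    f i + sum {n} (λ _ → 0#)   ≈⟨ +-congˡ (sum-replicate-zero n) ⟩
    f i + 0#                   ≈⟨ +-identityʳ (f i) ⟩
    f i                        ∎

  sum-supported-at₂ : ∀ {n} (f : Fin n → Carrier) {u v} → u ≢ v →
                      (∀ w → w ≢ u → w ≢ v → f w ≈ 0#) → sum f ≈ f u + f v
  sum-supported-at₂ {suc zero} f {zero} {zero} u≢u _ = contradiction ≡.refl u≢u
  sum-supported-at₂ {suc (suc n)} f {u} {v} u≢v vanish = begin
    sum f                      ≈⟨ sum-remove f ⟩
    f u + sum (f ∘ punchIn u)  ≈⟨ +-congˡ (sum-supported-at (f ∘ punchIn u) (punchOut u≢v) vanish′) ⟩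
    f u + f (punchIn u (punchOut u≢v)) ≡⟨ cong (λ w → f u + f w) (punchIn-punchOut u≢v) ⟩
    f u + f v                  ∎
    where
    vanish′ : ∀ j → j ≢ punchOut u≢v → f (punchIn u j) ≈ 0#
    vanish′ j j≢ = vanish (punchIn u j) (punchInᵢ≢i u j)
      (λ eq → j≢ (punchIn-injective u j (punchOut u≢v) (≡.trans eq (≡.sym (punchIn-punchOut u≢v)))))

  gram : ∀ {m n} → (Fin m → Fin n → Carrier) → Fin m → Fin m → Carrier
  gram {n = n} M i i′ = ∑[ j < n ] (M i j * M i′ j)

  gram-comm : ∀ {m n} (M : Fin m → Fin n → Carrier) i i′ → gram M i i′ ≈ gram M i′ i
  gram-comm M i i′ = sum-cong-≋ (λ j → *-comm (M i j) (M i′ j))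

  gram-apply : ∀ {m n} (M : Fin m → Fin n → Carrier) i (u : Fin m → Carrier) →
               ∑[ i′ < m ] (gram M i i′ * u i′) ≈ ∑[ j < n ] (M i j * ∑[ i′ < m ] (M i′ j * u i′))
  gram-apply M i u = sym (∑-bilinear (M i) (λ j i′ → M i′ j) u)

  gram-rowSum : ∀ {m n} (M : Fin m → Fin n → Carrier) i →
                ∑[ i′ < m ] gram M i i′ ≈ ∑[ j < n ] (M i j * ∑[ i′ < m ] M i′ j)
  gram-rowSum {m} {n} M i = begin
    ∑[ i′ < m ] gram M i i′                          ≈⟨ sum-cong-≋ (λ i′ → sym (*-identityʳ (gram M i i′))) ⟩
    ∑[ i′ < m ] (gram M i i′ * 1#)                   ≈⟨ gram-apply M i (λ _ → 1#) ⟩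
    ∑[ j < n ] (M i j * ∑[ i′ < m ] (M i′ j * 1#))
      ≈⟨ sum-cong-≋ (λ j → *-congˡ (sum-cong-≋ (λ i′ → *-identityʳ (M i′ j)))) ⟩
    ∑[ j < n ] (M i j * ∑[ i′ < m ] M i′ j)          ∎

open import Data.Nat using (_+_; _*_; ∣_-_∣)
open import Data.Nat.Properties
  using (+-*-commutativeSemiring; suc-injective; +-identityʳ; *-identityʳ; +-assoc; *-assoc; *-distribˡ-+;
         +-cancelˡ-≡; +-cancelʳ-≡; *-cancelˡ-≡; *-cancelʳ-≡; ≤-total; ≤-antisym; m≤m+n; +-mono-≤; +-monoʳ-≤;
         +-cancelʳ-≤; m≤n⇒∃[o]m+o≡n; m*n≡0⇒m≡0∨n≡0; ∣m-m+n∣≡n; ∣-∣-comm; ∣m-n∣≡0⇒m≡n)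
open ≡ using (sym; trans; subst)
open ≡.≡-Reasoning
open FiniteSums +-*-commutativeSemiring

sum-const : ∀ n c → ∑[ i < n ] c ≡ n * c
sum-const zero    c = refl
sum-const (suc n) c = cong (c +_) (sum-const n c)

sum-mono-≤ : ∀ {n} {f g : Fin n → ℕ} → (∀ i → f i ≤ g i) → sum f ≤ sum g
sum-mono-≤ {zero}  f≤g = z≤n
sum-mono-≤ {suc n} f≤g = +-mono-≤ (f≤g zero) (sum-mono-≤ (f≤g ∘ suc))

sum-mono-≤-≡⇒≡ : ∀ {n} {f g : Fin n → ℕ} → (∀ i → f i ≤ g i) → sum f ≡ sum g → ∀ i → f i ≡ g i
sum-mono-≤-≡⇒≡ {suc n} {f} {g} f≤g Σf≡Σg = λ { zero → head≡ ; (suc i) → sum-mono-≤-≡⇒≡ (f≤g ∘ suc) tail≡ i }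
  where
  head≡ : f zero ≡ g zero
  head≡ = ≤-antisym (f≤g zero) (+-cancelʳ-≤ (sum (f ∘ suc)) _ _
    (subst (g zero + sum (f ∘ suc) ≤_) (sym Σf≡Σg) (+-monoʳ-≤ (g zero) (sum-mono-≤ (f≤g ∘ suc)))))
  tail≡ : sum (f ∘ suc) ≡ sum (g ∘ suc)
  tail≡ = +-cancelˡ-≡ (f zero) _ _ (trans Σf≡Σg (cong (_+ sum (g ∘ suc)) (sym head≡)))

square-sum-gap : ∀ l x → x * x + l * l ≡ 2 * (l * x) + ∣ x - l ∣ * ∣ x - l ∣
square-sum-gap l x with ≤-total x l
... | inj₁ x≤l with m≤n⇒∃[o]m+o≡n x≤l
...   | d , refl = begin
  x * x + (x + d) * (x + d)        ≡⟨ expand x d ⟩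
  2 * ((x + d) * x) + d * d        ≡⟨ cong (λ e → 2 * ((x + d) * x) + e * e) (∣m-m+n∣≡n x d) ⟨
  2 * ((x + d) * x) + ∣ x - x + d ∣ * ∣ x - x + d ∣ ∎
  where
  expand : ∀ x d → x * x + (x + d) * (x + d) ≡ 2 * ((x + d) * x) + d * d
  expand = solve-∀
square-sum-gap l x | inj₂ l≤x with m≤n⇒∃[o]m+o≡n l≤x
...   | d , refl = begin
  (l + d) * (l + d) + l * l        ≡⟨ expand l d ⟩
  2 * (l * (l + d)) + d * d        ≡⟨ cong (λ e → 2 * (l * (l + d)) + e * e) (trans (∣-∣-comm (l + d) l) (∣m-m+n∣≡n l d)) ⟨
  2 * (l * (l + d)) + ∣ l + d - l ∣ * ∣ l + d - l ∣ ∎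
  where
  expand : ∀ l d → (l + d) * (l + d) + l * l ≡ 2 * (l * (l + d)) + d * d
  expand = solve-∀

2lx≤x²+l² : ∀ l x → 2 * (l * x) ≤ x * x + l * l
2lx≤x²+l² l x = subst (2 * (l * x) ≤_) (sym (square-sum-gap l x)) (m≤m+n _ _)

x²+l²≡2lx⇒x≡l : ∀ l x → x * x + l * l ≡ 2 * (l * x) → x ≡ l
x²+l²≡2lx⇒x≡l l x eq = [ ∣m-n∣≡0⇒m≡n , ∣m-n∣≡0⇒m≡n ]′ (m*n≡0⇒m≡0∨n≡0 ∣ x - l ∣ gap²≡0)
  where
  gap²≡0 : ∣ x - l ∣ * ∣ x - l ∣ ≡ 0
  gap²≡0 = +-cancelˡ-≡ (2 * (l * x)) _ 0 (trans (sym (square-sum-gap l x)) (trans eq (sym (+-identityʳ _))))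

indicator : Bool → ℕ
indicator b = if b then 1 else 0

indicator-∧ : ∀ a b → indicator (a ∧ b) ≡ indicator a * indicator b
indicator-∧ true  b = sym (+-identityʳ (indicator b))
indicator-∧ false b = refl

count≡sum : ∀ {n} (f : Fin n → Bool) → count f ≡ ∑[ i < n ] indicator (f i)
count≡sum {zero}  f = refl
count≡sum {suc n} f = cong (indicator (f zero) +_) (count≡sum (f ∘ suc))

count-∧ : ∀ {n} (f g : Fin n → Bool) → count (λ i → f i ∧ g i) ≡ ∑[ i < n ] (indicator (f i) * indicator (g i))
count-∧ f g = trans (count≡sum (λ i → f i ∧ g i)) (sum-cong-≗ (λ i → indicator-∧ (f i) (g i)))

count-remove : ∀ {n} (f : Fin (suc n) → Bool) {i} → f i ≡ true → count f ≡ suc (count (f ∘ punchIn i))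
count-remove f {i} fi = begin
  count f                                    ≡⟨ count≡sum f ⟩
  sum (indicator ∘ f)                        ≡⟨ sum-remove (indicator ∘ f) ⟩
  indicator (f i) + sum (indicator ∘ f ∘ punchIn i) ≡⟨ cong₂ _+_ (cong indicator (sym fi)) (count≡sum (f ∘ punchIn i)) ⟨
  suc (count (f ∘ punchIn i))                ∎

count-true≢0 : ∀ {n} (f : Fin n → Bool) {i} → f i ≡ true → count f ≢ 0
count-true≢0 {suc n} f fi count≡0 with () ← trans (sym (count-remove f fi)) count≡0

count≡suc⇒∃ : ∀ {n m} (f : Fin n → Bool) → count f ≡ suc m → ∃ λ i → f i ≡ true
count≡suc⇒∃ {suc n} f eq with f zero in f0
... | true  = zero , f0
... | false = let i , fi = count≡suc⇒∃ (f ∘ suc) eq in suc i , fi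

count≡2⇒∃other : ∀ {n} (f : Fin n → Bool) {p} → count f ≡ 2 → f p ≡ true → ∃ λ q → q ≢ p × f q ≡ true
count≡2⇒∃other {suc n} f {p} count≡2 fp =
  let j , fj = count≡suc⇒∃ (f ∘ punchIn p) (suc-injective (trans (sym (count-remove f fp)) count≡2))
  in punchIn p j , punchInᵢ≢i p j , fj

count≡2⇒≡∨≡ : ∀ {n} (f : Fin n → Bool) {u v w} → count f ≡ 2 → f u ≡ true → f v ≡ true → u ≢ v →
              f w ≡ true → w ≡ u ⊎ w ≡ v
count≡2⇒≡∨≡ {suc zero} f {zero} {zero} _ _ _ u≢u _ = contradiction refl u≢u
count≡2⇒≡∨≡ {suc (suc n)} f {u} {v} {w} count≡2 fu fv u≢v fw with w ≟ u | w ≟ v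
... | yes w≡u | _       = inj₁ w≡u
... | no _    | yes w≡v = inj₂ w≡v
... | no w≢u  | no w≢v  = contradiction count-h≡0 (count-true≢0 h h-true)
  where
  g : Fin (suc n) → Bool
  g = f ∘ punchIn u
  g-punchOut : ∀ {x} (u≢x : u ≢ x) → g (punchOut u≢x) ≡ f x
  g-punchOut u≢x = cong f (punchIn-punchOut u≢x)
  u≢w : u ≢ w
  u≢w = w≢u ∘ sym
  jv≢jw : punchOut u≢v ≢ punchOut u≢w
  jv≢jw = w≢v ∘ sym ∘ punchOut-injective u≢v u≢w
  h : Fin n → Bool
  h = g ∘ punchIn (punchOut u≢v)
  count-h≡0 : count h ≡ 0
  count-h≡0 = suc-injective (trans (sym (count-remove g (trans (g-punchOut u≢v) fv)))
                                   (suc-injective (trans (sym (count-remove f fu)) count≡2)))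
  h-true : h (punchOut jv≢jw) ≡ true
  h-true = trans (cong g (punchIn-punchOut jv≢jw)) (trans (g-punchOut u≢w) fw)

linear-solution-unique : ∀ {k} → 1 < k → ∀ {a b c d} → a * k + c ≡ a + d → b * k + c ≡ b + d → a ≡ b
linear-solution-unique {suc (suc k)} (s≤s (s≤s _)) {a} {b} {c} {d} eqa eqb =
  *-cancelʳ-≡ a b (suc k) (+-cancelʳ-≡ c _ _ (trans (excess eqa) (sym (excess eqb))))
  where
  shift : ∀ x k c → x * suc (suc k) + c ≡ x + (x * suc k + c)
  shift = solve-∀
  excess : ∀ {x} → x * suc (suc k) + c ≡ x + d → x * suc k + c ≡ d
  excess {x} eq = +-cancelˡ-≡ x _ _ (trans (sym (shift x k c)) eq)

variance-balance : ∀ k lam v s₁ s₂ → k + s₁ ≡ k * k → (k * k + s₂) + lam * k ≡ k * k + lam * (k * k) →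
                   k * k ≡ k + lam * v → s₂ + v * (lam * lam) ≡ 2 * (lam * s₁)
variance-balance k lam v s₁ s₂ h₁ h₂ h₃ = +-cancelʳ-≡ (2 * (lam * k)) _ _ (begin
  (s₂ + v * (lam * lam)) + 2 * (lam * k)   ≡⟨ regroup₁ k lam v s₂ ⟩
  (s₂ + lam * k) + lam * (k + lam * v)     ≡⟨ cong₂ (λ x y → x + lam * y) h₂′ (sym h₃) ⟩
  lam * (k * k) + lam * (k * k)            ≡⟨ cong (λ x → lam * x + lam * x) (sym h₁) ⟩
  lam * (k + s₁) + lam * (k + s₁)          ≡⟨ regroup₂ k lam s₁ ⟩
  2 * (lam * s₁) + 2 * (lam * k)           ∎)
  where
  h₂′ : s₂ + lam * k ≡ lam * (k * k)
  h₂′ = +-cancelˡ-≡ (k * k) _ _ (trans (sym (+-assoc (k * k) s₂ (lam * k))) h₂)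
  regroup₁ : ∀ k lam v s₂ → (s₂ + v * (lam * lam)) + 2 * (lam * k) ≡ (s₂ + lam * k) + lam * (k + lam * v)
  regroup₁ = solve-∀
  regroup₂ : ∀ k lam s₁ → lam * (k + s₁) + lam * (k + s₁) ≡ 2 * (lam * s₁) + 2 * (lam * k)
  regroup₂ = solve-∀

module SymmetricDesign {v k lam : ℕ} {A : Fin (suc v) → Fin (suc v) → Bool}
                       (design : IsSymmetricDesign (suc v) k lam A) where
  -- There are suc v points, so k(k − 1) = λ(v − 1) appears below as k * k ≡ k + lam * v.
  open IsSymmetricDesign design

  N : Fin (suc v) → Fin (suc v) → ℕ
  N p b = indicator (A p b)

  Nᵀ : Fin (suc v) → Fin (suc v) → ℕ
  Nᵀ b p = N p b

  replication : Fin (suc v) → ℕ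
  replication p = ∑[ b < suc v ] N p b

  N-idem : ∀ p b → N p b * N p b ≡ N p b
  N-idem p b with A p b
  ... | true  = refl
  ... | false = refl

  blockSize-∑ : ∀ b → ∑[ p < suc v ] N p b ≡ k
  blockSize-∑ b = trans (sym (count≡sum (λ p → A p b))) (blockSize b)

  gram-N-diag : ∀ p → gram N p p ≡ replication p
  gram-N-diag p = sum-cong-≗ (N-idem p)

  gram-N-off : ∀ {p q} → p ≢ q → gram N p q ≡ lam
  gram-N-off {p} {q} p≢q = trans (sym (count-∧ (A p) (A q))) (pairCount p q p≢q)

  block-self-meet : ∀ b → count (λ p → A p b ∧ A p b) ≡ k
  block-self-meet b = trans (count-∧ (λ p → A p b) (λ p → A p b)) (trans (sum-cong-≗ (λ p → N-idem p b)) (blockSize-∑ b))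

  gram-N-action : ∀ p (u : Fin (suc v) → ℕ) →
                  ∑[ q < suc v ] (gram N p q * u q) + lam * u p ≡ replication p * u p + lam * sum u
  gram-N-action p u = begin
    ∑[ q < suc v ] (gram N p q * u q) + lam * u p
      ≡⟨ cong (_+ lam * u p) (sum-remove (λ q → gram N p q * u q)) ⟩
    (gram N p p * u p + ∑[ j < v ] (gram N p (punchIn p j) * u (punchIn p j))) + lam * u p
      ≡⟨ cong₂ (λ x y → (x * u p + y) + lam * u p) (gram-N-diag p) (sum-cong-≗ off-diagonal) ⟩
    (replication p * u p + ∑[ j < v ] (lam * u (punchIn p j))) + lam * u p
      ≡⟨ regroup (replication p * u p) _ (lam * u p) ⟩
    replication p * u p + (lam * u p + ∑[ j < v ] (lam * u (punchIn p j)))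
      ≡⟨ cong (λ x → replication p * u p + (lam * u p + x)) (*-distribˡ-sum lam (u ∘ punchIn p)) ⟨
    replication p * u p + (lam * u p + lam * ∑[ j < v ] u (punchIn p j))
      ≡⟨ cong (replication p * u p +_) (*-distribˡ-+ lam (u p) _) ⟨
    replication p * u p + lam * (u p + ∑[ j < v ] u (punchIn p j))
      ≡⟨ cong (λ x → replication p * u p + lam * x) (sum-remove u) ⟨
    replication p * u p + lam * sum u ∎
    where
    off-diagonal : ∀ j → gram N p (punchIn p j) * u (punchIn p j) ≡ lam * u (punchIn p j)
    off-diagonal j = cong (_* u (punchIn p j)) (gram-N-off (punchInᵢ≢i p j ∘ sym))
    regroup : ∀ a s b → (a + s) + b ≡ a + (b + s)
    regroup = solve-∀

  replication-equation : ∀ p → replication p * k + lam ≡ replication p + lam * suc v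
  replication-equation p = begin
    replication p * k + lam
      ≡⟨ cong₂ _+_ row-sum (sym (*-identityʳ lam)) ⟩
    ∑[ q < suc v ] (gram N p q * 1) + lam * 1
      ≡⟨ gram-N-action p (λ _ → 1) ⟩
    replication p * 1 + lam * ∑[ q < suc v ] 1
      ≡⟨ cong₂ _+_ (*-identityʳ (replication p)) (cong (lam *_) (trans (sum-const (suc v) 1) (*-identityʳ (suc v)))) ⟩
    replication p + lam * suc v ∎
    where
    row-sum : replication p * k ≡ ∑[ q < suc v ] (gram N p q * 1)
    row-sum = begin
      replication p * k                               ≡⟨ *-distribʳ-sum k (N p) ⟩
      ∑[ b < suc v ] (N p b * k)                      ≡⟨ sum-cong-≗ (λ b → cong (N p b *_) (blockSize-∑ b)) ⟨
      ∑[ b < suc v ] (N p b * ∑[ q < suc v ] N q b)   ≡⟨ gram-rowSum N p ⟨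
      ∑[ q < suc v ] gram N p q                       ≡⟨ sum-cong-≗ (λ q → *-identityʳ (gram N p q)) ⟨
      ∑[ q < suc v ] (gram N p q * 1)                 ∎

  replication≡k : 1 < k → ∀ p → replication p ≡ k
  replication≡k 1<k p = *-cancelˡ-≡ (replication p) k (suc v) (begin
    suc v * replication p                  ≡⟨ sum-const (suc v) (replication p) ⟨
    ∑[ q < suc v ] replication p           ≡⟨ sum-cong-≗ uniform ⟩
    ∑[ q < suc v ] replication q           ≡⟨ ∑-comm N ⟩
    ∑[ b < suc v ] ∑[ q < suc v ] N q b    ≡⟨ sum-cong-≗ blockSize-∑ ⟩
    ∑[ b < suc v ] k                       ≡⟨ sum-const (suc v) k ⟩
    suc v * k                              ∎)
    where
    uniform : ∀ q → replication p ≡ replication q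
    uniform q = linear-solution-unique 1<k {replication p} {replication q} {lam} {lam * suc v}
                  (replication-equation p) (replication-equation q)

  k²≡k+λv : 1 < k → k * k ≡ k + lam * v
  k²≡k+λv 1<k = +-cancelʳ-≡ lam _ _ (begin
    k * k + lam        ≡⟨ subst (λ r → r * k + lam ≡ r + lam * suc v) (replication≡k 1<k zero) (replication-equation zero) ⟩
    k + lam * suc v    ≡⟨ regroup k lam v ⟩
    k + lam * v + lam  ∎)
    where
    regroup : ∀ k lam v → k + lam * suc v ≡ k + lam * v + lam
    regroup = solve-∀

  gram-Nᵀ-diag : ∀ b → gram Nᵀ b b ≡ k
  gram-Nᵀ-diag b = trans (sum-cong-≗ (λ p → N-idem p b)) (blockSize-∑ b)

  gram-Nᵀ-rowSum : 1 < k → ∀ b → ∑[ b′ < suc v ] gram Nᵀ b b′ ≡ k * k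
  gram-Nᵀ-rowSum 1<k b = begin
    ∑[ b′ < suc v ] gram Nᵀ b b′                           ≡⟨ gram-rowSum Nᵀ b ⟩
    ∑[ p < suc v ] (N p b * replication p)                 ≡⟨ sum-cong-≗ (λ p → cong (N p b *_) (replication≡k 1<k p)) ⟩
    ∑[ p < suc v ] (N p b * k)                             ≡⟨ *-distribʳ-sum k (Nᵀ b) ⟨
    ∑[ p < suc v ] N p b * k                               ≡⟨ cong (_* k) (blockSize-∑ b) ⟩
    k * k                                                  ∎

  gram-Nᵀ-squareSum : 1 < k → ∀ b → ∑[ b′ < suc v ] (gram Nᵀ b b′ * gram Nᵀ b b′) + lam * k ≡ k * k + lam * (k * k)
  gram-Nᵀ-squareSum 1<k b = begin
    ∑[ b′ < suc v ] (gram Nᵀ b b′ * gram Nᵀ b b′) + lam * k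
      ≡⟨ cong (_+ lam * k) (trans (gram-apply Nᵀ b (gram Nᵀ b)) (sum-cong-≗ (λ p → cong (N p b *_) (weighted p)))) ⟩
    ∑[ p < suc v ] (N p b * X p) + lam * k
      ≡⟨ cong (λ s → ∑[ p < suc v ] (N p b * X p) + lam * s) (gram-Nᵀ-diag b) ⟨
    ∑[ p < suc v ] (N p b * X p) + lam * gram Nᵀ b b
      ≡⟨ cong (∑[ p < suc v ] (N p b * X p) +_) (*-distribˡ-sum lam (λ p → N p b * N p b)) ⟩
    ∑[ p < suc v ] (N p b * X p) + ∑[ p < suc v ] (lam * (N p b * N p b))
      ≡⟨ ∑-distrib-+ (λ p → N p b * X p) (λ p → lam * (N p b * N p b)) ⟨
    ∑[ p < suc v ] (N p b * X p + lam * (N p b * N p b))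
      ≡⟨ sum-cong-≗ (λ p → trans (factor (N p b) (X p) lam) (cong (N p b *_) (action p))) ⟩
    ∑[ p < suc v ] (N p b * (k * N p b + lam * k))
      ≡⟨ sum-cong-≗ (λ p → expand (N p b) k lam) ⟩
    ∑[ p < suc v ] (k * (N p b * N p b) + lam * k * N p b)
      ≡⟨ ∑-distrib-+ (λ p → k * (N p b * N p b)) (λ p → lam * k * N p b) ⟩
    ∑[ p < suc v ] (k * (N p b * N p b)) + ∑[ p < suc v ] (lam * k * N p b)
      ≡⟨ cong₂ _+_ (*-distribˡ-sum k (λ p → N p b * N p b)) (*-distribˡ-sum (lam * k) (Nᵀ b)) ⟨
    k * gram Nᵀ b b + lam * k * ∑[ p < suc v ] N p b
      ≡⟨ cong₂ (λ x y → k * x + lam * k * y) (gram-Nᵀ-diag b) (blockSize-∑ b) ⟩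
    k * k + lam * k * k
      ≡⟨ cong (k * k +_) (*-assoc lam k k) ⟩
    k * k + lam * (k * k) ∎
    where
    X : Fin (suc v) → ℕ
    X p = ∑[ q < suc v ] (gram N p q * N q b)
    weighted : ∀ p → ∑[ b′ < suc v ] (N p b′ * gram Nᵀ b b′) ≡ X p
    weighted p = trans (sum-cong-≗ (λ b′ → cong (N p b′ *_) (gram-comm Nᵀ b b′))) (sym (gram-apply N p (Nᵀ b)))
    action : ∀ p → X p + lam * N p b ≡ k * N p b + lam * k
    action p = trans (gram-N-action p (Nᵀ b)) (cong₂ (λ r s → r * N p b + lam * s) (replication≡k 1<k p) (blockSize-∑ b))
    factor : ∀ a x l → a * x + l * (a * a) ≡ a * (x + l * a)
    factor = solve-∀
    expand : ∀ a k l → a * (k * a + l * k) ≡ k * (a * a) + l * k * a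
    expand = solve-∀

  blocks-meet : 1 < k → ∀ {b b′} → b ≢ b′ → count (λ p → A p b ∧ A p b′) ≡ lam
  blocks-meet 1<k {b} {b′} b≢b′ = begin
    count (λ p → A p b ∧ A p b′)                 ≡⟨ count-∧ (λ p → A p b) (λ p → A p b′) ⟩
    gram Nᵀ b b′                                 ≡⟨ cong (gram Nᵀ b) (punchIn-punchOut b≢b′) ⟨
    μ (punchOut b≢b′)                            ≡⟨ μ≡lam (punchOut b≢b′) ⟩
    lam                                          ∎
    where
    μ : Fin v → ℕ
    μ j = gram Nᵀ b (punchIn b j)
    h₁ : k + sum μ ≡ k * k
    h₁ = trans (cong (_+ sum μ) (sym (gram-Nᵀ-diag b))) (trans (sym (sum-remove (gram Nᵀ b))) (gram-Nᵀ-rowSum 1<k b))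
    h₂ : (k * k + ∑[ j < v ] (μ j * μ j)) + lam * k ≡ k * k + lam * (k * k)
    h₂ = trans (cong (λ x → (x * x + ∑[ j < v ] (μ j * μ j)) + lam * k) (sym (gram-Nᵀ-diag b)))
               (trans (cong (_+ lam * k) (sym (sum-remove (λ b′ → gram Nᵀ b b′ * gram Nᵀ b b′))))
                      (gram-Nᵀ-squareSum 1<k b))
    balanced : ∑[ j < v ] (μ j * μ j + lam * lam) ≡ ∑[ j < v ] (2 * (lam * μ j))
    balanced = begin
      ∑[ j < v ] (μ j * μ j + lam * lam)                ≡⟨ ∑-distrib-+ (λ j → μ j * μ j) (λ _ → lam * lam) ⟩
      ∑[ j < v ] (μ j * μ j) + ∑[ j < v ] (lam * lam)   ≡⟨ cong (∑[ j < v ] (μ j * μ j) +_) (sum-const v (lam * lam)) ⟩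
      ∑[ j < v ] (μ j * μ j) + v * (lam * lam)          ≡⟨ variance-balance k lam v (sum μ) _ h₁ h₂ (k²≡k+λv 1<k) ⟩
      2 * (lam * sum μ)                                 ≡⟨ cong (2 *_) (*-distribˡ-sum lam μ) ⟩
      2 * ∑[ j < v ] (lam * μ j)                        ≡⟨ *-distribˡ-sum 2 (λ j → lam * μ j) ⟩
      ∑[ j < v ] (2 * (lam * μ j))                      ∎
    μ≡lam : ∀ j → μ j ≡ lam
    μ≡lam j = x²+l²≡2lx⇒x≡l lam (μ j) (sym (sum-mono-≤-≡⇒≡ (λ j → 2lx≤x²+l² lam (μ j)) (sym balanced) j))

module GF = FiniteSums GF3-commutativeSemiring
open CommutativeSemiring GF3-commutativeSemiring using ()
  renaming (zeroʳ to ⊗-zeroʳ; +-identityʳ to ⊕-identityʳ; +-monoid to ⊕-monoid)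
open import Algebra.Properties.Monoid.Mult ⊕-monoid using () renaming (_×_ to _×₃_; ×-homo-+ to ×₃-homo-+)

Σ₃≡sum : ∀ n (f : Fin n → GF3) → Σ₃ n f ≡ GF.sum f
Σ₃≡sum zero    f = refl
Σ₃≡sum (suc n) f = cong (f zero ⊕_) (Σ₃≡sum n (f ∘ suc))

dot≡sum : ∀ {n} (u c : Fin n → GF3) → dot u c ≡ GF.sum (λ j → u j ⊗ c j)
dot≡sum u c = Σ₃≡sum _ (λ j → u j ⊗ c j)

dot-append0 : ∀ {n} (u : Fin (suc n) → GF3) (c : Fin n → GF3) → dot u (append0 c) ≡ dot (u ∘ inject₁) c
dot-append0 {zero}  u c = trans (⊕-identityʳ (u zero ⊗ 𝟘)) (⊗-zeroʳ (u zero))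
dot-append0 {suc n} u c = cong ((u zero ⊗ c zero) ⊕_) (dot-append0 (u ∘ suc) (c ∘ suc))

InDual⇒orthogonal : ∀ {m n} (M : Fin m → Fin n → GF3) c → InDual M c → ∀ i → dot (M i) c ≡ 𝟘
InDual⇒orthogonal {suc m} M c dual i =
  dual (M i) (δ , λ j → sym (trans (Σ₃≡sum (suc m) (λ i′ → δ i′ ⊗ M i′ j)) (picks j)))
  where
  δ : Fin (suc m) → GF3
  δ i′ = if does (i′ ≟ i) then 𝟙 else 𝟘
  picks : ∀ j → GF.sum (λ i′ → δ i′ ⊗ M i′ j) ≡ M i j
  picks j = trans (GF.sum-supported-at (λ i′ → δ i′ ⊗ M i′ j) i
                     (λ i′ i′≢i → cong (λ b → (if b then 𝟙 else 𝟘) ⊗ M i′ j) (dec-false (i′ ≟ i) i′≢i)))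
                  (cong (λ b → (if b then 𝟙 else 𝟘) ⊗ M i j) (dec-true (i ≟ i) refl))

orthogonal⇒InDual : ∀ {m n} (M : Fin m → Fin n → GF3) c → (∀ i → dot (M i) c ≡ 𝟘) → InDual M c
orthogonal⇒InDual {m} {n} M c orth w (a , w≡aM) = begin
  dot w c
    ≡⟨ dot≡sum w c ⟩
  GF.sum (λ j → w j ⊗ c j)
    ≡⟨ GF.sum-cong-≗ (λ j → cong (_⊗ c j) (trans (w≡aM j) (Σ₃≡sum m (λ i → a i ⊗ M i j)))) ⟩
  GF.sum (λ j → GF.sum (λ i → a i ⊗ M i j) ⊗ c j)
    ≡⟨ GF.∑-bilinear a M c ⟨
  GF.sum (λ i → a i ⊗ GF.sum (λ j → M i j ⊗ c j))
    ≡⟨ GF.sum-cong-≗ (λ i → cong (a i ⊗_) (trans (sym (dot≡sum (M i) c)) (orth i))) ⟩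
  GF.sum (λ i → a i ⊗ 𝟘)
    ≡⟨ GF.sum-cong-≗ (λ i → ⊗-zeroʳ (a i)) ⟩
  GF.sum {m} (λ _ → 𝟘)
    ≡⟨ GF.sum-replicate-zero m ⟩
  𝟘 ∎

toGF3-∧ : ∀ a b → toGF3 (a ∧ b) ≡ toGF3 a ⊗ toGF3 b
toGF3-∧ true  b = refl
toGF3-∧ false b = refl

sum-toGF3 : ∀ {n} (f : Fin n → Bool) → GF.sum (λ i → toGF3 (f i)) ≡ count f ×₃ 𝟙
sum-toGF3 {zero}  f = refl
sum-toGF3 {suc n} f = trans (cong₂ _⊕_ (head (f zero)) (sum-toGF3 (f ∘ suc)))
                            (sym (×₃-homo-+ 𝟙 (indicator (f zero)) (count (f ∘ suc))))
  where
  head : ∀ b → toGF3 b ≡ indicator b ×₃ 𝟙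
  head true  = refl
  head false = refl

sum-0/1≡weight : ∀ {n} (c : Fin n → GF3) → (∀ j → c j ≡ 𝟘 ⊎ c j ≡ 𝟙) → GF.sum c ≡ weight c ×₃ 𝟙
sum-0/1≡weight c c01 = trans (GF.sum-cong-≗ indicator-of-support) (sum-toGF3 (λ j → if isZero (c j) then false else true))
  where
  indicator-of-support : ∀ j → c j ≡ toGF3 (if isZero (c j) then false else true)
  indicator-of-support j with c01 j
  ... | inj₁ c≡𝟘 rewrite c≡𝟘 = refl
  ... | inj₂ c≡𝟙 rewrite c≡𝟙 = refl

∧-true : ∀ {a b} → a ∧ b ≡ true → a ≡ true × b ≡ true
∧-true {true} b≡true = refl , b≡true

below-45⇒↑ˡ : (p : Fin 56) → (45 ≤ᵇ toℕ p) ≡ false → ∃ λ p′ → p ≡ p′ ↑ˡ 11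
below-45⇒↑ˡ p p<45 with splitAt 45 p in eq
... | inj₁ p′ = p′ , sym (splitAt⁻¹-↑ˡ eq)
... | inj₂ q with () ← trans (cong (45 ≤ᵇ_) (sym (toℕ-↑ʳ 45 q)))
                             (trans (cong (λ i → 45 ≤ᵇ toℕ i) (splitAt⁻¹-↑ʳ {i = p} eq)) p<45)

module _ (A : Fin 56 → Fin 56 → Bool) (design : IsSymmetricDesign 56 11 2 A)
         (lastBlock≡B : (p : Fin 56) → A p lastBlock ≡ (45 ≤ᵇ toℕ p))
         (c : Fin 55 → GF3) (c∈01 : (j : Fin 55) → (c j ≡ 𝟘) ⊎ (c j ≡ 𝟙))
         (weight≡12 : weight c ≡ 12) (c∈L″⊥ : InDual (A'' A) c) where
  open IsSymmetricDesign design
  open SymmetricDesign design using (blocks-meet; block-self-meet)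

  -- Opaque so that goals mentioning x are never normalised to its 56-term sum.
  opaque
    x : Fin 56 → GF3
    x p = dot (ternA A p) (append0 c)

    x≡dot : ∀ p → x p ≡ dot (ternA A p) (append0 c)
    x≡dot p = refl

  -- 11 ≡ 2 (mod 3): over GF(3) the diagonal and off-diagonal entries of AᵀA agree.
  column-products≡𝟚 : ∀ b b′ → GF.sum (λ p → ternA A p b ⊗ ternA A p b′) ≡ 𝟚
  column-products≡𝟚 b b′ = trans (GF.sum-cong-≗ (λ p → sym (toGF3-∧ (A p b) (A p b′))))
                               (trans (sum-toGF3 (λ p → A p b ∧ A p b′)) (meet (b ≟ b′)))
    where
    meet : Dec (b ≡ b′) → count (λ p → A p b ∧ A p b′) ×₃ 𝟙 ≡ 𝟚
    meet (yes refl) = cong (_×₃ 𝟙) (block-self-meet b)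
    meet (no b≢b′)  = cong (_×₃ 𝟙) (blocks-meet (s≤s (s≤s z≤n)) b≢b′)

  sum-c*≡𝟘 : GF.sum (append0 c) ≡ 𝟘
  sum-c*≡𝟘 = begin
    GF.sum (append0 c)        ≡⟨ Σ₃≡sum 56 (append0 c) ⟨
    dot (λ _ → 𝟙) (append0 c) ≡⟨ dot-append0 (λ _ → 𝟙) c ⟩
    dot (λ _ → 𝟙) c           ≡⟨ Σ₃≡sum 55 c ⟩
    GF.sum c                  ≡⟨ sum-0/1≡weight c c∈01 ⟩
    weight c ×₃ 𝟙             ≡⟨ cong (_×₃ 𝟙) weight≡12 ⟩
    𝟘                         ∎

  Aᵀx≡𝟘 : ∀ b → GF.sum (λ p → ternA A p b ⊗ x p) ≡ 𝟘
  Aᵀx≡𝟘 b = begin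
    GF.sum (λ p → ternA A p b ⊗ x p)
      ≡⟨ GF.sum-cong-≗ (λ p → cong (ternA A p b ⊗_) (trans (x≡dot p) (dot≡sum (ternA A p) (append0 c)))) ⟩
    GF.sum (λ p → ternA A p b ⊗ GF.sum (λ b′ → ternA A p b′ ⊗ append0 c b′))
      ≡⟨ GF.∑-bilinear (λ p → ternA A p b) (ternA A) (append0 c) ⟩
    GF.sum (λ b′ → GF.sum (λ p → ternA A p b ⊗ ternA A p b′) ⊗ append0 c b′)
      ≡⟨ GF.sum-cong-≗ (λ b′ → cong (_⊗ append0 c b′) (column-products≡𝟚 b b′)) ⟩
    GF.sum (λ b′ → 𝟚 ⊗ append0 c b′)
      ≡⟨ GF.*-distribˡ-sum 𝟚 (append0 c) ⟨
    𝟚 ⊗ GF.sum (append0 c)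
      ≡⟨ cong (𝟚 ⊗_) sum-c*≡𝟘 ⟩
    𝟘 ∎

  x-outside-B : ∀ p → A p lastBlock ≡ false → x p ≡ 𝟘
  x-outside-B p p∉B with below-45⇒↑ˡ p (trans (sym (lastBlock≡B p)) p∉B)
  ... | p′ , refl = begin
    x (p′ ↑ˡ 11)                          ≡⟨ x≡dot (p′ ↑ˡ 11) ⟩
    dot (ternA A (p′ ↑ˡ 11)) (append0 c)  ≡⟨ dot-append0 (ternA A (p′ ↑ˡ 11)) c ⟩
    dot (A'' A p′) c                      ≡⟨ InDual⇒orthogonal (A'' A) c c∈L″⊥ p′ ⟩
    𝟘                                     ∎

  x-pair : ∀ {u v} → A u lastBlock ≡ true → A v lastBlock ≡ true → u ≢ v → x u ⊕ x v ≡ 𝟘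
  x-pair {u} {v} u∈B v∈B u≢v = begin
    x u ⊕ x v                                         ≡⟨ cong₂ (λ s t → (toGF3 s ⊗ x u) ⊕ (toGF3 t ⊗ x v)) u∈b v∈b ⟨
    (ternA A u b ⊗ x u) ⊕ (ternA A v b ⊗ x v)         ≡⟨ GF.sum-supported-at₂ (λ p → ternA A p b ⊗ x p) u≢v vanish ⟨
    GF.sum (λ p → ternA A p b ⊗ x p)                  ≡⟨ Aᵀx≡𝟘 b ⟩
    𝟘                                                 ∎
    where
    other-block : ∃ λ b → b ≢ lastBlock × A u b ∧ A v b ≡ true
    other-block = count≡2⇒∃other (λ b → A u b ∧ A v b) (pairCount u v u≢v) (cong₂ _∧_ u∈B v∈B)
    b : Fin 56
    b = proj₁ other-block
    b≢B : b ≢ lastBlock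
    b≢B = proj₁ (proj₂ other-block)
    u∈b : A u b ≡ true
    u∈b = proj₁ (∧-true (proj₂ (proj₂ other-block)))
    v∈b : A v b ≡ true
    v∈b = proj₂ (∧-true (proj₂ (proj₂ other-block)))
    vanish : ∀ w → w ≢ u → w ≢ v → ternA A w b ⊗ x w ≡ 𝟘
    vanish w w≢u w≢v = by-membership (A w lastBlock) (A w b) refl refl
      where
      by-membership : ∀ β γ → A w lastBlock ≡ β → A w b ≡ γ → ternA A w b ⊗ x w ≡ 𝟘
      by-membership false _     w∉B _   = trans (cong (ternA A w b ⊗_) (x-outside-B w w∉B)) (⊗-zeroʳ (ternA A w b))
      by-membership true  false _   w∉b = cong (λ β → toGF3 β ⊗ x w) w∉b
      by-membership true  true  w∈B w∈b = [ flip contradiction w≢u , flip contradiction w≢v ]′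
        (count≡2⇒≡∨≡ (λ p → A p b ∧ A p lastBlock) (blocks-meet (s≤s (s≤s z≤n)) b≢B)
                      (cong₂ _∧_ u∈b u∈B) (cong₂ _∧_ v∈b v∈B) u≢v (cong₂ _∧_ w∈b w∈B))

  pairs-in-B⇒x≡𝟘 : ∀ {q u v} → A q lastBlock ≡ true → A u lastBlock ≡ true → A v lastBlock ≡ true →
               q ≢ u → q ≢ v → u ≢ v → x q ≡ 𝟘
  pairs-in-B⇒x≡𝟘 q∈B u∈B v∈B q≢u q≢v u≢v =
    pairwise-sums-𝟘⇒𝟘 _ _ _ (x-pair q∈B u∈B q≢u) (x-pair q∈B v∈B q≢v) (x-pair u∈B v∈B u≢v)

  x≡𝟘 : ∀ q → x q ≡ 𝟘
  x≡𝟘 q with A q lastBlock in q∈B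
  ... | false = x-outside-B q q∈B
  ... | true with q ≟ # 45 | q ≟ # 46
  ...   | yes refl | _        = pairs-in-B⇒x≡𝟘 q∈B (lastBlock≡B (# 46)) (lastBlock≡B (# 47)) (λ ()) (λ ()) (λ ())
  ...   | no q≢45  | yes refl = pairs-in-B⇒x≡𝟘 q∈B (lastBlock≡B (# 45)) (lastBlock≡B (# 47)) (λ ()) (λ ()) (λ ())
  ...   | no q≢45  | no q≢46  = pairs-in-B⇒x≡𝟘 q∈B (lastBlock≡B (# 45)) (lastBlock≡B (# 46)) q≢45 q≢46 (λ ())

  rows-orthogonal : ∀ p → dot (ternA A p) (append0 c) ≡ 𝟘
  rows-orthogonal p = trans (sym (x≡dot p)) (x≡𝟘 p)

lemma2 : (A : Fin 56 → Fin 56 → Bool)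
    → IsSymmetricDesign 56 11 2 A
    → ((p : Fin 56) → A p lastBlock ≡ (45 ≤ᵇ toℕ p))
    → (c : Fin 55 → GF3)
    → ((j : Fin 55) → (c j ≡ 𝟘) ⊎ (c j ≡ 𝟙))
    → weight c ≡ 12
    → InDual (A'' A) c
    → InDual (ternA A) (append0 c)
lemma2 A design lastBlock≡B c c∈01 weight≡12 c∈L″⊥ =
  orthogonal⇒InDual (ternA A) (append0 c) (rows-orthogonal A design lastBlock≡B c c∈01 weight≡12 c∈L″⊥)
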